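{- Let $G$ be a finite undirected graph and consider any candy-passing game on $G$ (with any initial distribution of $c>0$ candies among the vertices). Then there is a finite number $N$ of rounds such that after round $N$: the set of abundant vertices of $G$ no longer changes in any later round, and every vertex in this set holds the same number of candies after every later round.
   Context: The candy-passing game on a finite undirected graph $G$ (with vertex set $V(G)$ and edge set $E(G)$): initially a total of $c>0$ candies is distributed among the vertices of $G$ (each vertex holding a nonnegative integer number of candies). The game proceeds in rounds. In each round, simultaneously, every vertex $v$ that at the start of the round holds at least $\deg(v)$ candies passes one candy to each of its neighbors; a vertex holding fewer than $\deg(v)$ candies at the start of the round passes nothing. Here $\deg(v)$ is the number of neighbors of $v$. A vertex $v$ is called abundant (at a given time) if it holds at least $2\deg(v)$ candies. A vertex is said to have stabilized after some round if the number of candies it holds remains constant throughout all subsequent rounds. -}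

module Defs where

open import Data.Nat using (ℕ; zero; suc; _+_; _*_; _∸_; _≤_; _<_)
open import Data.Nat.Properties using (_≤?_)
open import Data.Fin using (Fin; zero; suc)
open import Data.Bool using (Bool; true; false; if_then_else_; T; not)
open import Relation.Nullary.Decidable using (⌊_⌋)
open import Relation.Binary.PropositionalEquality using (_≡_)

ΣFin : ∀ {n} → (Fin n → ℕ) → ℕ
ΣFin {zero}  f = 0
ΣFin {suc n} f = f zero + ΣFin (λ i → f (suc i))

record Graph (n : ℕ) : Set where
  field
    adj   : Fin n → Fin n → Bool
    sym   : ∀ u v → adj u v ≡ adj v u
    loopless : ∀ v → adj v v ≡ false

open Graph public

deg : ∀ {n} → Graph n → Fin n → ℕ
deg G v = ΣFin (λ u → if adj G v u then 1 else 0)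

Config : ℕ → Set
Config n = Fin n → ℕ

total : ∀ {n} → Config n → ℕ
total c = ΣFin c

fires : ∀ {n} → Graph n → Config n → Fin n → Bool
fires G c v = ⌊ deg G v ≤? c v ⌋

step : ∀ {n} → Graph n → Config n → Config n
step G c v =
  (if fires G c v then c v ∸ deg G v else c v)
  + ΣFin (λ u → if adj G v u then (if fires G c u then 1 else 0) else 0)

play : ∀ {n} → Graph n → Config n → ℕ → Config n
play G c zero    = c
play G c (suc k) = step G (play G c k)

Abundant : ∀ {n} → Graph n → Config n → Fin n → Set
Abundant G c v = 2 * deg G v ≤ c v

module Submission where

-- The candy-passing game reaches a finite-state cycle, and along every
-- round the abundant vertices only lose status and candies; together these
-- force the abundant set and the abundant counts to be constant on the cycle.
--
-- 1. Domination.  Say d dominates e if every vertex abundant in e is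
--    abundant in d and holds at most as many candies in e as in d.  A
--    configuration dominates its successor (an abundant vertex after a round
--    must have fired in it, and a firing vertex receives at most deg v back),
--    hence dominates every later configuration.
-- 2. Boundedness.  Consequently vertex v never holds more than c v + 2 deg v
--    candies, so only finitely many configurations occur; encoding them into
--    a Fin type, the pigeonhole principle yields a round i and a period
--    suc q with play (suc q + i) ≗ play i.
-- 3. Recurrence.  From round i every configuration is dominated by play i
--    and, since the play returns to play i, dominates play i as well.  Mutual
--    domination is exactly the conclusion of lemma1 with N = i.

open import Defs hiding (sym)
open import Data.Nat using (ℕ; zero; suc; _+_; _*_; _∸_; _≤_; _<_; z≤n; s≤s)
open import Data.Nat.Properties
open import Data.Fin using (Fin; zero; suc; toℕ; fromℕ<; combine)
import Data.Fin.Properties as Fin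
open import Data.Bool using (Bool; true; false; if_then_else_)
open import Data.Product using (Σ; ∃₂; _×_; _,_; proj₁; proj₂)
open import Function.Bundles using (_⇔_; mk⇔)
open import Relation.Binary.PropositionalEquality
  using (_≡_; _≗_; refl; sym; trans; cong; cong₂; subst; module ≡-Reasoning)
open import Relation.Nullary using (yes; no; contradiction)

ΣFin-mono : ∀ {n} (f g : Fin n → ℕ) → (∀ i → f i ≤ g i) → ΣFin f ≤ ΣFin g
ΣFin-mono {zero}  f g f≤g = z≤n
ΣFin-mono {suc n} f g f≤g =
  +-mono-≤ (f≤g zero) (ΣFin-mono (λ i → f (suc i)) (λ i → g (suc i)) (λ i → f≤g (suc i)))

ΣFin-cong : ∀ {n} (f g : Fin n → ℕ) → f ≗ g → ΣFin f ≡ ΣFin g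
ΣFin-cong {zero}  f g f≗g = refl
ΣFin-cong {suc n} f g f≗g =
  cong₂ _+_ (f≗g zero) (ΣFin-cong (λ i → f (suc i)) (λ i → g (suc i)) (λ i → f≗g (suc i)))

module Game {n} (G : Graph n) where

  received : Config n → Fin n → ℕ
  received c v = ΣFin (λ u → if adj G v u then (if fires G c u then 1 else 0) else 0)

  received≤deg : ∀ c v → received c v ≤ deg G v
  received≤deg c v = ΣFin-mono _ _ (λ u → indicator≤ (adj G v u) (fires G c u))
    where
    indicator≤ : (a b : Bool) → (if a then (if b then 1 else 0) else 0) ≤ (if a then 1 else 0)
    indicator≤ true  true  = ≤-refl
    indicator≤ true  false = z≤n
    indicator≤ false b     = z≤n

  step-cong : ∀ c c' → c ≗ c' → step G c ≗ step G c'
  step-cong c c' c≗c' v =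
    cong₂ _+_ (cong₂ (λ b x → if b then x ∸ deg G v else x) (fires≡ v) (c≗c' v))
              (ΣFin-cong _ _ (λ u → cong (λ b → if adj G v u then (if b then 1 else 0) else 0) (fires≡ u)))
    where
    fires≡ : ∀ u → fires G c u ≡ fires G c' u
    fires≡ u rewrite c≗c' u = refl

  play-cong : ∀ c c' → c ≗ c' → ∀ t → play G c t ≗ play G c' t
  play-cong c c' c≗c' zero    = c≗c'
  play-cong c c' c≗c' (suc t) = step-cong _ _ (play-cong c c' c≗c' t)

  play-+ : ∀ c t a → play G c (t + a) ≡ play G (play G c a) t
  play-+ c zero    a = refl
  play-+ c (suc t) a = cong (step G) (play-+ c t a)

  Dominates : Config n → Config n → Set
  Dominates d e = ∀ v → Abundant G e v → Abundant G d v × e v ≤ d v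

  dominates-refl : ∀ d → Dominates d d
  dominates-refl d v abundant = abundant , ≤-refl

  dominates-trans : ∀ d e f → Dominates d e → Dominates e f → Dominates d f
  dominates-trans d e f d≽e e≽f v abundant-f =
    let abundant-e , f≤e = e≽f v abundant-f
        abundant-d , e≤d = d≽e v abundant-e
    in  abundant-d , ≤-trans f≤e e≤d

  dominates-respʳ : ∀ d e e' → e ≗ e' → Dominates d e → Dominates d e'
  dominates-respʳ d e e' e≗e' d≽e v abundant rewrite sym (e≗e' v) = d≽e v abundant

  mutually-dominating : ∀ d e → Dominates d e → Dominates e d →
    (∀ v → Abundant G e v ⇔ Abundant G d v) × (∀ v → Abundant G d v → e v ≡ d v)
  mutually-dominating d e d≽e e≽d =
      (λ v → mk⇔ (λ abundant → proj₁ (d≽e v abundant)) (λ abundant → proj₁ (e≽d v abundant)))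
    , (λ v abundant → let abundant-e , d≤e = e≽d v abundant in ≤-antisym (proj₂ (d≽e v abundant-e)) d≤e)

  -- The key local fact: a vertex abundant after a round fired in that round
  -- (otherwise it holds < deg + deg), and then it lost deg and got ≤ deg back.
  step-dominated : ∀ d → Dominates d (step G d)
  step-dominated d v abundant with deg G v ≤? d v
  ... | yes deg≤d = ≤-trans abundant after≤before , after≤before
    where
    after≤before : (d v ∸ deg G v) + received d v ≤ d v
    after≤before = begin
      (d v ∸ deg G v) + received d v ≤⟨ +-monoʳ-≤ (d v ∸ deg G v) (received≤deg d v) ⟩
      (d v ∸ deg G v) + deg G v      ≡⟨ m∸n+n≡m deg≤d ⟩
      d v                            ∎
      where open ≤-Reasoning
  ... | no deg≰d = contradiction abundant (<⇒≱ after<2deg)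
    where
    after<2deg : d v + received d v < 2 * deg G v
    after<2deg = begin-strict
      d v + received d v   <⟨ +-mono-<-≤ (≰⇒> deg≰d) (received≤deg d v) ⟩
      deg G v + deg G v    ≡⟨ cong (deg G v +_) (sym (+-identityʳ (deg G v))) ⟩
      2 * deg G v          ∎
      where open ≤-Reasoning

  play-dominated : ∀ c t → Dominates c (play G c t)
  play-dominated c zero    = dominates-refl c
  play-dominated c (suc t) = dominates-trans _ _ _ (play-dominated c t) (step-dominated (play G c t))

  earlier-dominates : ∀ c a t → Dominates (play G c a) (play G c (t + a))
  earlier-dominates c a t rewrite play-+ c t a = play-dominated (play G c a) t

  capacity : Config n → Config n
  capacity c v = c v + 2 * deg G v

  play-bounded : ∀ c t v → play G c t v ≤ capacity c v
  play-bounded c t v with 2 * deg G v ≤? play G c t v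
  ... | yes abundant = ≤-trans (proj₂ (play-dominated c t v abundant)) (m≤m+n (c v) _)
  ... | no ¬abundant = ≤-trans (<⇒≤ (≰⇒> ¬abundant)) (m≤n+m _ (c v))

-- Functions bounded pointwise by B form a finite set of size ∏ (1 + B v):
-- they are encoded injectively in Fin (states B), digit by digit.
states : ∀ {n} → (Fin n → ℕ) → ℕ
states {zero}  B = 1
states {suc n} B = suc (B zero) * states (λ i → B (suc i))

digit : ∀ {n} (B f : Fin (suc n) → ℕ) → (∀ v → f v ≤ B v) → Fin (suc (B zero))
digit B f f≤B = fromℕ< (s≤s (f≤B zero))

encode : ∀ {n} (B f : Fin n → ℕ) → (∀ v → f v ≤ B v) → Fin (states B)
encode {zero}  B f f≤B = zero
encode {suc n} B f f≤B =
  combine (digit B f f≤B) (encode (λ i → B (suc i)) (λ i → f (suc i)) (λ i → f≤B (suc i)))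

encode-injective : ∀ {n} (B f g : Fin n → ℕ) (f≤B : ∀ v → f v ≤ B v) (g≤B : ∀ v → g v ≤ B v) →
                   encode B f f≤B ≡ encode B g g≤B → f ≗ g
encode-injective {suc n} B f g f≤B g≤B same v
  with Fin.combine-injective (digit B f f≤B) _ (digit B g g≤B) _ same
... | same-digit , same-rest with v
...   | zero  = Fin.fromℕ<-injective _ _ _ _ same-digit
...   | suc w = encode-injective (λ i → B (suc i)) (λ i → f (suc i)) (λ i → g (suc i))
                  (λ i → f≤B (suc i)) (λ i → g≤B (suc i)) same-rest w

bounded-recurs : ∀ {n} (B : Fin n → ℕ) (x : ℕ → Fin n → ℕ) → (∀ t v → x t v ≤ B v) →
                 ∃₂ λ i q → x (suc q + i) ≗ x i
bounded-recurs B x x≤B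
  with Fin.pigeonhole (n<1+n (states B)) (λ k → encode B (x (toℕ k)) (x≤B (toℕ k)))
... | i , j , i<j , same = toℕ i , toℕ j ∸ suc (toℕ i) , λ v → trans (cong (λ t → x t v) j≡) (sym (x-i≗x-j v))
  where
  x-i≗x-j : x (toℕ i) ≗ x (toℕ j)
  x-i≗x-j = encode-injective B _ _ (x≤B (toℕ i)) (x≤B (toℕ j)) same
  j≡ : suc (toℕ j ∸ suc (toℕ i)) + toℕ i ≡ toℕ j
  j≡ = trans (sym (+-suc (toℕ j ∸ suc (toℕ i)) (toℕ i))) (m∸n+n≡m i<j)

module Recurrence {n} (G : Graph n) (c : Config n) (i q : ℕ)
                  (returns : play G c (suc q + i) ≗ play G c i) where
  open Game G

  returns-often : ∀ k → play G c (k * suc q + i) ≗ play G c i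
  returns-often zero    v = refl
  returns-often (suc k) v = begin
    play G c (suc q + k * suc q + i) v   ≡⟨ cong (λ t → play G c t v) (+-assoc (suc q) (k * suc q) i) ⟩
    play G c (suc q + (k * suc q + i)) v ≡⟨ cong (λ x → x v) (play-+ c (suc q) (k * suc q + i)) ⟩
    play G (play G c (k * suc q + i)) (suc q) v ≡⟨ play-cong _ _ (returns-often k) (suc q) v ⟩
    play G (play G c i) (suc q) v        ≡⟨ cong (λ x → x v) (sym (play-+ c (suc q) i)) ⟩
    play G c (suc q + i) v               ≡⟨ returns v ⟩
    play G c i v                         ∎
    where open ≡-Reasoning

  -- Every configuration from round i on dominates play i, which recurs at
  -- round s * suc q + i (play i dominates them by earlier-dominates).
  dominates-start : ∀ s → Dominates (play G c (s + i)) (play G c i)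
  dominates-start s =
    dominates-respʳ _ _ _ (returns-often s)
      (subst (λ t → Dominates (play G c (s + i)) (play G c t)) rounds
        (earlier-dominates c (s + i) (s * q)))
    where
    rounds : s * q + (s + i) ≡ s * suc q + i
    rounds = begin
      s * q + (s + i) ≡⟨ sym (+-assoc (s * q) s i) ⟩
      s * q + s + i   ≡⟨ cong (_+ i) (+-comm (s * q) s) ⟩
      s + s * q + i   ≡⟨ cong (_+ i) (sym (*-suc s q)) ⟩
      s * suc q + i   ∎
      where open ≡-Reasoning

-- Stabilisation from the first recurrent round i.
lemma1 : ∀ {n} (G : Graph n) (c : Config n) → 0 < total c →
    Σ ℕ (λ N → ∀ m → N ≤ m →
      (∀ v → Abundant G (play G c m) v ⇔ Abundant G (play G c N) v)
      × (∀ v → Abundant G (play G c N) v → play G c m v ≡ play G c N v))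
lemma1 G c _ with bounded-recurs (Game.capacity G c) (play G c) (Game.play-bounded G c)
... | i , q , returns = i , λ m i≤m → stable (m ∸ i) m (sym (m∸n+n≡m i≤m))
  where
  open Game G
  open Recurrence G c i q returns
  stable : ∀ s m → m ≡ s + i →
    (∀ v → Abundant G (play G c m) v ⇔ Abundant G (play G c i) v)
    × (∀ v → Abundant G (play G c i) v → play G c m v ≡ play G c i v)
  stable s m refl = mutually-dominating _ _ (earlier-dominates c i s) (dominates-start s)
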